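{- Let $m>2$ be an integer, $n=3m$, and let $a,b$ be integers with $a\equiv 2\pmod 3$ and $b\equiv 2\pmod 3$ such that the $n$-tuple $(a,b,a,\,a,b,a,\,\ldots,\,a,b,a)$ (block $(a,b,a)$ repeated $m$ times) represents an $m$-axial $3m$-polygon. Then there are integers $a',b'$, both congruent to $1$ mod $3$, such that $(a',b',a',\,a',b',a',\,\ldots,\,a',b',a')$ represents the same polygon.
   Context: Let $V_n=\{v_k=e^{2\pi i k/n}: k=0,\dots,n-1\}\subset\mathbb{C}$. An $n$-polygon is a closed polygonal path visiting every point of $V_n$ exactly once (a Hamiltonian cycle on $V_n$ drawn with straight segments), regarded as a set of segments. An $n$-tuple $(e_1,\dots,e_n)$ with entries in $\{1,\dots,n-1\}$ represents the path starting at $v_0$ and moving successively to $v_{s_1},\dots,v_{s_n}$, where $s_k=e_1+\dots+e_k$ (indices mod $n$); it represents an $n$-polygon iff $n\nmid s_k$ for $1\le k\le n-1$ and $n\mid s_n$. A symmetry axis of an $n$-polygon is a line through $0$ such that reflection in it maps the polygon onto itself. An $m$-axial $3m$-polygon is a $3m$-polygon with exactly $m$ symmetry axes. -}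

module Defs where

open import Data.Nat using (ℕ; zero; suc; _+_; _*_; _∸_; _≤_; _<_)
open import Data.Nat.Divisibility using (_∣_)
open import Data.Nat.DivMod using (_%_)
open import Data.Integer as ℤ using (ℤ; +_)
import Data.Integer.Divisibility as ℤd
open import Data.List using (List; map; upTo)
open import Data.Nat.ListAction using (sum)
open import Data.Fin using (Fin; toℕ)
open import Data.Fin.Subset using (Subset; _∈_; ∣_∣)
open import Data.Product using (Σ; ∃; _×_)
open import Data.Sum using (_⊎_)
open import Relation.Nullary using (¬_)
open import Relation.Binary.PropositionalEquality using (_≡_)
open import Function.Bundles using (_⇔_)

_≡[_]_ : ℕ → ℕ → ℕ → Set
x ≡[ n ] y = (+ n) ℤd.∣ ((+ x) ℤ.- (+ y))

-- An n-tuple is given as a function e : ℕ → ℕ, of which only e 0 … e (n-1)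
-- are relevant (e i is the paper's e_{i+1}).
-- Partial sum s_k = e_1 + … + e_k.
S : (ℕ → ℕ) → ℕ → ℕ
S e k = sum (map e (upTo k))

IsPolygon : ℕ → (ℕ → ℕ) → Set
IsPolygon n e =
  (∀ i → i < n → 1 ≤ e i × e i ≤ n ∸ 1) ×
  (∀ k → 1 ≤ k → k ≤ n ∸ 1 → ¬ (n ∣ S e k)) ×
  (n ∣ S e n)

-- The (unordered) segment between v_x and v_y (x, y vertex indices in Fin n)
-- belongs to the path represented by e: it is the segment from v_{s_k}
-- to v_{s_{k+1}} for some 0 ≤ k < n (s_0 = 0).
Edge : (n : ℕ) → (ℕ → ℕ) → Fin n → Fin n → Set
Edge n e x y = ∃ λ k → k < n ×
  ((toℕ x ≡[ n ] S e k × toℕ y ≡[ n ] S e (suc k)) ⊎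
   (toℕ y ≡[ n ] S e k × toℕ x ≡[ n ] S e (suc k)))

SamePolygon : (n : ℕ) → (ℕ → ℕ) → (ℕ → ℕ) → Set
SamePolygon n e e' = ∀ x y → Edge n e x y ⇔ Edge n e' x y

-- Reflections of the plane mapping V_n to itself are exactly the maps
-- v_k ↦ v_{j-k} (j ∈ Z_n); these correspond bijectively to the n lines
-- through 0 at angles πj/n.  A reflection maps the polygon onto itself iff
-- it maps its segment set onto itself.  IsAxis n e j : the line at angle πj/n
-- is a symmetry axis of the polygon represented by e.
IsAxis : (n : ℕ) → (ℕ → ℕ) → Fin n → Set
IsAxis n e j = ∀ (x y x' y' : Fin n) →
  (toℕ x + toℕ x') ≡[ n ] toℕ j → (toℕ y + toℕ y') ≡[ n ] toℕ j →
  (Edge n e x y ⇔ Edge n e x' y')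

HasExactlyAxes : (n : ℕ) → (ℕ → ℕ) → ℕ → Set
HasExactlyAxes n e c = Σ (Subset n) λ A → (∀ j → (j ∈ A) ⇔ IsAxis n e j) × ∣ A ∣ ≡ c

IsAxialPolygon : ℕ → (ℕ → ℕ) → Set
IsAxialPolygon m e = IsPolygon (3 * m) e × HasExactlyAxes (3 * m) e m

blk : ℕ → ℕ → ℕ → ℕ
blk a b zero = a
blk a b (suc zero) = b
blk a b (suc (suc zero)) = a
blk a b (suc (suc (suc i))) = blk a b i

-- With n = 3m the tuple (a,b,a, …, a,b,a) is a palindrome, so s_k + s_(n-k) = s_n ≡ 0 (mod n).
-- The complementary tuple (n-a, n-b, n-a, …) has partial sums kn - s_k ≡ s_(n-k) (mod n),
-- i.e. it traverses the same polygon backwards; and n - a ≡ n - b ≡ 1 (mod 3) because 3 ∣ n.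
module Submission where

open import Defs
open import Data.Nat using (ℕ; zero; suc; _+_; _*_; _∸_; _≤_; _<_; s≤s; z<s)
open import Data.Nat.DivMod using (_%_; %-distribˡ-+; m%n<n; m*n%n≡0)
open import Data.Product using (∃₂; _×_; _,_; proj₁; proj₂; uncurry)
open import Relation.Binary.PropositionalEquality
  using (_≡_; refl; sym; trans; cong; cong₂; subst; subst₂; module ≡-Reasoning)
open import Data.Nat.Properties
open import Data.Nat.Divisibility using (_∣_; n∣m*n; _∣0)
open import Data.Integer as ℤ using (ℤ; +_)
import Data.Integer.Divisibility.Signed as ℤ∣
open import Data.Integer.Tactic.RingSolver using (solve-∀)
open import Data.List using (_++_; [_]; map; upTo)
open import Data.List.Properties using (upTo-∷ʳ; map-++)
open import Data.Nat.ListAction using (sum)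
open import Data.Nat.ListAction.Properties using (sum-++)
open import Data.Sum using (_⊎_; inj₁; inj₂)
open import Data.Fin using (toℕ)
open import Function.Bundles using (mk⇔)
open import Relation.Nullary using (¬_)
open import Algebra.Properties.CommutativeSemigroup +-commutativeSemigroup
  using (interchange; xy∙z≈x∙zy; x∙yz≈y∙xz)

module _ {n : ℕ} where

  private
    signed : ∀ x y → x ≡[ n ] y → + n ℤ∣.∣ (+ x ℤ.- + y)
    signed x y = ℤ∣.∣ᵤ⇒∣

    signed-∣ : ∀ x → n ∣ x → + n ℤ∣.∣ + x
    signed-∣ x = ℤ∣.∣ᵤ⇒∣

  ≡[]-sym : ∀ x y → x ≡[ n ] y → y ≡[ n ] x
  ≡[]-sym x y x≡y = ℤ∣.∣⇒∣ᵤ (subst (+ n ℤ∣.∣_) (negate-sub (+ x) (+ y)) (ℤ∣.∣m⇒∣-m (signed x y x≡y)))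
    where
    negate-sub : ∀ (X Y : ℤ) → ℤ.- (X ℤ.- Y) ≡ Y ℤ.- X
    negate-sub = solve-∀

  ≡[]-trans : ∀ x y z → x ≡[ n ] y → y ≡[ n ] z → x ≡[ n ] z
  ≡[]-trans x y z x≡y y≡z =
    ℤ∣.∣⇒∣ᵤ (subst (+ n ℤ∣.∣_) (telescope (+ x) (+ y) (+ z)) (ℤ∣.∣m∣n⇒∣m+n (signed x y x≡y) (signed y z y≡z)))
    where
    telescope : ∀ (X Y Z : ℤ) → (X ℤ.- Y) ℤ.+ (Y ℤ.- Z) ≡ X ℤ.- Z
    telescope = solve-∀

  ∣∣⇒≡[] : ∀ x y → n ∣ x → n ∣ y → x ≡[ n ] y
  ∣∣⇒≡[] x y n∣x n∣y = ℤ∣.∣⇒∣ᵤ (ℤ∣.∣m∣n⇒∣m-n (signed-∣ x n∣x) (signed-∣ y n∣y))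

  ∣-resp-≡[] : ∀ x y → x ≡[ n ] y → n ∣ y → n ∣ x
  ∣-resp-≡[] x y x≡y n∣y =
    ℤ∣.∣⇒∣ᵤ (subst (+ n ℤ∣.∣_) (sub-add (+ x) (+ y)) (ℤ∣.∣m∣n⇒∣m+n (signed x y x≡y) (signed-∣ y n∣y)))
    where
    sub-add : ∀ (X Y : ℤ) → (X ℤ.- Y) ℤ.+ Y ≡ X
    sub-add = solve-∀

  +-cancel-≡[] : ∀ x y z → (x + z) ≡[ n ] (z + y) → x ≡[ n ] y
  +-cancel-≡[] x y z eq = ℤ∣.∣⇒∣ᵤ (subst (+ n ℤ∣.∣_) (cancel (+ x) (+ y) (+ z)) (signed (x + z) (z + y) eq))
    where
    cancel : ∀ (X Y Z : ℤ) → (X ℤ.+ Z) ℤ.- (Z ℤ.+ Y) ≡ X ℤ.- Y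
    cancel = solve-∀

S-suc : ∀ (g : ℕ → ℕ) k → S g (suc k) ≡ S g k + g k
S-suc g k = begin
  sum (map g (upTo (suc k)))       ≡⟨ cong (λ is → sum (map g is)) (sym (upTo-∷ʳ k)) ⟩
  sum (map g (upTo k ++ [ k ]))    ≡⟨ cong sum (map-++ g (upTo k) [ k ]) ⟩
  sum (map g (upTo k) ++ [ g k ])  ≡⟨ sum-++ (map g (upTo k)) [ g k ] ⟩
  S g k + (g k + 0)                ≡⟨ cong (λ x → S g k + x) (+-identityʳ (g k)) ⟩
  S g k + g k                      ∎
  where open ≡-Reasoning

S-complement : ∀ {c} (f g : ℕ → ℕ) k → (∀ i → i < k → f i + g i ≡ c) → S f k + S g k ≡ k * c
S-complement f g zero _ = refl
S-complement {c} f g (suc k) f+g≡c = begin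
  S f (suc k) + S g (suc k)      ≡⟨ cong₂ _+_ (S-suc f k) (S-suc g k) ⟩
  (S f k + f k) + (S g k + g k)  ≡⟨ interchange (S f k) (f k) (S g k) (g k) ⟩
  (S f k + S g k) + (f k + g k)  ≡⟨ cong₂ _+_ (S-complement f g k (λ i i<k → f+g≡c i (m<n⇒m<1+n i<k)))
                                               (f+g≡c k ≤-refl) ⟩
  k * c + c                      ≡⟨ +-comm (k * c) c ⟩
  suc k * c                      ∎
  where open ≡-Reasoning

Palindromic : ℕ → (ℕ → ℕ) → Set
Palindromic n g = ∀ i j → i + suc j ≡ n → g i ≡ g j

S-palindromic : ∀ {n g} → Palindromic n g → ∀ k l → k + l ≡ n → S g k + S g l ≡ S g n
S-palindromic pal zero l refl = refl
S-palindromic {n} {g} pal (suc k) l 1+k+l≡n = begin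
  S g (suc k) + S g l    ≡⟨ cong (_+ S g l) (S-suc g k) ⟩
  S g k + g k + S g l    ≡⟨ xy∙z≈x∙zy (S g k) (g k) (S g l) ⟩
  S g k + (S g l + g k)  ≡⟨ cong (λ x → S g k + (S g l + x)) (pal k l k+1+l≡n) ⟩
  S g k + (S g l + g l)  ≡⟨ cong (λ x → S g k + x) (sym (S-suc g l)) ⟩
  S g k + S g (suc l)    ≡⟨ S-palindromic pal k (suc l) k+1+l≡n ⟩
  S g n                  ∎
  where
  open ≡-Reasoning
  k+1+l≡n : k + suc l ≡ n
  k+1+l≡n = trans (+-suc k l) 1+k+l≡n

-- f traverses the path of e backwards (both start at vertex 0).
Reverses : ℕ → (ℕ → ℕ) → (ℕ → ℕ) → Set
Reverses n f e = ∀ k l → k + l ≡ n → S f k ≡[ n ] S e l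

Reverses-sym : ∀ {n f e} → Reverses n f e → Reverses n e f
Reverses-sym {f = f} {e} rev k l k+l≡n = ≡[]-sym (S f l) (S e k) (rev l k (trans (+-comm l k) k+l≡n))

Reverses⇒Edge : ∀ {n f e x y} → Reverses n f e → Edge n e x y → Edge n f x y
Reverses⇒Edge {n} {f} {e} {x} {y} rev (k , k<n , ends) with m≤n⇒∃[o]m+o≡n k<n
... | j , 1+k+j≡n = j , j<n , swap ends
  where
  j<n : j < n
  j<n = subst (j <_) 1+k+j≡n (m<n+m j z<s)

  start : S e k ≡[ n ] S f (suc j)
  start = Reverses-sym rev k (suc j) (trans (+-suc k j) 1+k+j≡n)

  end : S e (suc k) ≡[ n ] S f j
  end = Reverses-sym rev (suc k) j 1+k+j≡n

  swap : (toℕ x ≡[ n ] S e k × toℕ y ≡[ n ] S e (suc k)) ⊎ (toℕ y ≡[ n ] S e k × toℕ x ≡[ n ] S e (suc k)) →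
         (toℕ x ≡[ n ] S f j × toℕ y ≡[ n ] S f (suc j)) ⊎ (toℕ y ≡[ n ] S f j × toℕ x ≡[ n ] S f (suc j))
  swap (inj₁ (x≡ , y≡)) = inj₂ (≡[]-trans _ _ (S f j) y≡ end , ≡[]-trans _ _ (S f (suc j)) x≡ start)
  swap (inj₂ (y≡ , x≡)) = inj₁ (≡[]-trans _ _ (S f j) x≡ end , ≡[]-trans _ _ (S f (suc j)) y≡ start)

Reverses⇒SamePolygon : ∀ {n f e} → Reverses n f e → SamePolygon n e f
Reverses⇒SamePolygon rev x y = mk⇔ (Reverses⇒Edge rev) (Reverses⇒Edge (Reverses-sym rev))

Entries : ℕ → (ℕ → ℕ) → Set
Entries n e = ∀ i → i < n → 1 ≤ e i × e i ≤ n ∸ 1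

≤∸1⇒< : ∀ {x n} → 1 ≤ x → x ≤ n ∸ 1 → x < n
≤∸1⇒< {suc x} {suc n} _ x≤n = s≤s x≤n

Reverses⇒IsPolygon : ∀ {n f e} → Reverses n f e → Entries n f → IsPolygon n e → IsPolygon n f
Reverses⇒IsPolygon {n} {f} {e} rev f-entries (_ , e-avoids , e-closes) = f-entries , f-avoids , f-closes
  where
  f-avoids : ∀ k → 1 ≤ k → k ≤ n ∸ 1 → ¬ (n ∣ S f k)
  f-avoids k 1≤k k≤n∸1 n∣Sfk = e-avoids (n ∸ k) (m<n⇒0<n∸m k<n) (∸-monoʳ-≤ n 1≤k) n∣Se[n∸k]
    where
    k<n : k < n
    k<n = ≤∸1⇒< 1≤k k≤n∸1

    n∣Se[n∸k] : n ∣ S e (n ∸ k)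
    n∣Se[n∸k] = ∣-resp-≡[] (S e (n ∸ k)) (S f k) (Reverses-sym rev (n ∸ k) k (m∸n+n≡m (<⇒≤ k<n))) n∣Sfk

  f-closes : n ∣ S f n
  f-closes = ∣-resp-≡[] (S f n) 0 (rev n 0 (+-identityʳ n)) (n ∣0)

IsComplement : ℕ → (ℕ → ℕ) → (ℕ → ℕ) → Set
IsComplement n f e = ∀ i → i < n → f i ≡ n ∸ e i

complement-Entries : ∀ {n f e} → IsComplement n f e → Entries n e → Entries n f
complement-Entries {n} {f} {e} f≡n∸e e-entries i i<n =
  subst (λ x → 1 ≤ x × x ≤ n ∸ 1) (sym (f≡n∸e i i<n)) (m<n⇒0<n∸m (≤∸1⇒< 1≤ei ei≤n∸1) , ∸-monoʳ-≤ n 1≤ei)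
  where
  1≤ei : 1 ≤ e i
  1≤ei = proj₁ (e-entries i i<n)
  ei≤n∸1 : e i ≤ n ∸ 1
  ei≤n∸1 = proj₂ (e-entries i i<n)

complement-Reverses : ∀ {n f e} → Palindromic n e → IsComplement n f e → Entries n e → n ∣ S e n → Reverses n f e
complement-Reverses {n} {f} {e} pal f≡n∸e e-entries n∣Sen k l k+l≡n =
  +-cancel-≡[] (S f k) (S e l) (S e k)
    (subst₂ _≡[ n ]_ (sym (S-complement f e k f+e≡n)) (sym (S-palindromic pal k l k+l≡n))
      (∣∣⇒≡[] (k * n) (S e n) (n∣m*n k) n∣Sen))
  where
  f+e≡n : ∀ i → i < k → f i + e i ≡ n
  f+e≡n i i<k = trans (cong (_+ e i) (f≡n∸e i i<n)) (m∸n+n≡m (<⇒≤ (uncurry ≤∸1⇒< (e-entries i i<n))))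
    where
    i<n : i < n
    i<n = <-≤-trans i<k (subst (k ≤_) k+l≡n (m≤m+n k l))

blk-map : ∀ (h : ℕ → ℕ) a b i → blk (h a) (h b) i ≡ h (blk a b i)
blk-map h a b 0 = refl
blk-map h a b 1 = refl
blk-map h a b 2 = refl
blk-map h a b (suc (suc (suc i))) = blk-map h a b i

blk-mirror : ∀ {a b} i j → (i + suc j) % 3 ≡ 0 → blk a b i ≡ blk a b j
blk-mirror (suc (suc (suc i))) j eq = blk-mirror i j eq
blk-mirror i (suc (suc (suc j))) eq = blk-mirror i j (trans (cong (_% 3) (sym (x∙yz≈y∙xz i 3 (suc j)))) eq)
blk-mirror 0 0 ()
blk-mirror 0 1 ()
blk-mirror 0 2 _ = refl
blk-mirror 1 0 ()
blk-mirror 1 1 _ = refl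
blk-mirror 1 2 ()
blk-mirror 2 0 _ = refl
blk-mirror 2 1 ()
blk-mirror 2 2 ()

blk-palindromic : ∀ {a b n} → n % 3 ≡ 0 → Palindromic n (blk a b)
blk-palindromic n%3≡0 i j i+1+j≡n = blk-mirror i j (trans (cong (_% 3) i+1+j≡n) n%3≡0)

complement-residue : ∀ {n a} → n % 3 ≡ 0 → a % 3 ≡ 2 → a ≤ n → (n ∸ a) % 3 ≡ 1
complement-residue {n} {a} n%3≡0 a%3≡2 a≤n = residue ((n ∸ a) % 3) (m%n<n (n ∸ a) 3) (begin
  ((n ∸ a) % 3 + 2) % 3      ≡⟨ cong (λ r → ((n ∸ a) % 3 + r) % 3) (sym a%3≡2) ⟩
  ((n ∸ a) % 3 + a % 3) % 3  ≡⟨ sym (%-distribˡ-+ (n ∸ a) a 3) ⟩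
  ((n ∸ a) + a) % 3          ≡⟨ cong (_% 3) (m∸n+n≡m a≤n) ⟩
  n % 3                      ≡⟨ n%3≡0 ⟩
  0                          ∎)
  where
  open ≡-Reasoning
  residue : ∀ r → r < 3 → (r + 2) % 3 ≡ 0 → r ≡ 1
  residue 0 _ ()
  residue 1 _ _ = refl
  residue 2 _ ()
  residue (suc (suc (suc _))) (s≤s (s≤s (s≤s ()))) _

lemma5 : ∀ (m a b : ℕ) → 2 < m → a % 3 ≡ 2 → b % 3 ≡ 2 →
    IsAxialPolygon m (blk a b) →
    ∃₂ λ a' b' → a' % 3 ≡ 1 × b' % 3 ≡ 1 ×
      IsPolygon (3 * m) (blk a' b') × SamePolygon (3 * m) (blk a b) (blk a' b')
lemma5 m a b 2<m a%3≡2 b%3≡2 (polygon@(entries , _ , closes) , _) =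
  n ∸ a , n ∸ b ,
  complement-residue n%3≡0 a%3≡2 (entry≤n 0 z<s) ,
  complement-residue n%3≡0 b%3≡2 (entry≤n 1 (s≤s z<s)) ,
  Reverses⇒IsPolygon reversal (complement-Entries complement entries) polygon ,
  Reverses⇒SamePolygon reversal
  where
  n : ℕ
  n = 3 * m

  n%3≡0 : n % 3 ≡ 0
  n%3≡0 = trans (cong (_% 3) (*-comm 3 m)) (m*n%n≡0 m 3)

  entry≤n : ∀ i → i < 3 → blk a b i ≤ n
  entry≤n i i<3 = ≤-trans (proj₂ (entries i (<-≤-trans i<3 (≤-trans 2<m (m≤n*m m 3))))) (m∸n≤m n 1)

  complement : IsComplement n (blk (n ∸ a) (n ∸ b)) (blk a b)
  complement i _ = blk-map (n ∸_) a b i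

  reversal : Reverses n (blk (n ∸ a) (n ∸ b)) (blk a b)
  reversal = complement-Reverses (blk-palindromic n%3≡0) complement entries closes
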